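{- Let $\overrightarrow{G}$ be a DDMOG on $n$ vertices with $imb(\overrightarrow{G})=0$, with DDM labeling $g$ and vertices indexed $v_1,\dots,v_n$ so that $g(v_i)=i$. Let $\overrightarrow{H}$ be an oriented graph, vertex-disjoint from $\overrightarrow{G}$, with bijective labeling $h:V(\overrightarrow{H})\to\{1,2,\dots,m\}$ such that for every $v\in V(\overrightarrow{H})$ either $m+1\le|wt_h(v)|\le m+n$ or $wt_h(v)=0$, and such that $\sum_{v\in V_h^{i+m}(\overrightarrow{H})} h(v)=\sum_{v\in V_h^{ -i-m}(\overrightarrow{H})} h(v)$ for each $1\le i\le n$. Then $\overrightarrow{G}\oplus_{wt_h}^m\overrightarrow{H}$ is a DDMOG on $n+m$ vertices.
   Context: An oriented graph is a digraph with no loops, no multiple arcs, and such that $(u,v)$ being an arc implies $(v,u)$ is not an arc. $N^+(v)$ is the set of $u$ with $(u,v)$ an arc, $N^-(v)$ the set of $u$ with $(v,u)$ an arc; $imb(v)=|N^+(v)|-|N^-(v)|$ and $imb(D)=\max_v|imb(v)|$. For a labeling $f$, $wt_f(v)=\sum_{u\in N^+(v)} f(u) - \sum_{u \in N^-(v)} f(u)$. A DDM labeling of an oriented graph on $n$ vertices is a bijection $f:V\to\{1,\dots,n\}$ with $wt_f(v)=0$ for all $v$; a DDMOG is an oriented graph admitting one. For a labeling $h$ of $\overrightarrow{H}$ and integer $j$, $V_h^{j}(\overrightarrow{H})=\{u: wt_h(u)=j\}$. Weighted sum: with $\overrightarrow{G}$'s vertices $v_1,\dots,v_n$ indexed so $g(v_i)=i$,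 integer $s$, and $\overrightarrow{H}$ vertex-disjoint from $\overrightarrow{G}$ with labeling $h:V(\overrightarrow{H})\to\mathbb{Z}^+$ such that $\{|wt_h(u)|\}\subseteq\{0\}\cup\{i+s:1\le i\le n\}$, the graph $\overrightarrow{G}\oplus_{wt_h}^s\overrightarrow{H}$ has vertex set $V(\overrightarrow{G})\cup V(\overrightarrow{H})$ and arc set $E(\overrightarrow{G})\cup E(\overrightarrow{H})\cup\bigcup_{i=1}^n(E^i\cup E^{ -i})$, where $E^i=\{(v_i,u): u\in V_h^{ -i-s}(\overrightarrow{H})\}$ and $E^{ -i}=\{(u,v_i): u\in V_h^{i+s}(\overrightarrow{H})\}$. -}

module Defs where

open import Data.Bool using (Bool; true; false; if_then_else_)
open import Data.Nat as ℕ using (ℕ; zero; suc)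
open import Data.Integer as ℤ using (ℤ; +_; -_; ∣_∣)
open import Data.Fin using (Fin; zero; suc; splitAt)
open import Data.Sum using (_⊎_; inj₁; inj₂)
open import Data.Product using (_×_; ∃; Σ)
open import Relation.Binary.PropositionalEquality using (_≡_)
open import Relation.Nullary using (does)
open import Function.Definitions using (Injective)

-- A digraph on the vertex set Fin n, given by its (decidable) arc relation:
-- arc u v ≡ true  means  (u , v) is an arc.
Digraph : ℕ → Set
Digraph n = Fin n → Fin n → Bool

-- Oriented graph: no loops, and (u,v) an arc implies (v,u) not an arc.
-- (No multiple arcs is automatic for a relation.)
IsOriented : ∀ {n} → Digraph n → Set
IsOriented {n} D = (∀ v → D v v ≡ false) × (∀ u v → D u v ≡ true → D v u ≡ false)

sumℤ : ∀ n → (Fin n → ℤ) → ℤ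
sumℤ zero    f = + 0
sumℤ (suc n) f = f zero ℤ.+ sumℤ n (λ i → f (suc i))

sumℕ : ∀ n → (Fin n → ℕ) → ℕ
sumℕ zero    f = 0
sumℕ (suc n) f = f zero ℕ.+ sumℕ n (λ i → f (suc i))

wt : ∀ {n} → Digraph n → (Fin n → ℕ) → Fin n → ℤ
wt {n} D f v =
  sumℤ n (λ u → if D u v then + f u else + 0)
  ℤ.- sumℤ n (λ u → if D v u then + f u else + 0)

indeg outdeg : ∀ {n} → Digraph n → Fin n → ℕ
indeg  {n} D v = sumℕ n (λ u → if D u v then 1 else 0)
outdeg {n} D v = sumℕ n (λ u → if D v u then 1 else 0)

imb : ∀ {n} → Digraph n → Fin n → ℤ
imb D v = + indeg D v ℤ.- + outdeg D v

-- imb(D) = max_v |imb(v)| = 0, i.e. every vertex has imbalance 0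
ImbZero : ∀ {n} → Digraph n → Set
ImbZero D = ∀ v → imb D v ≡ + 0

IsBijLabeling : ∀ n → (Fin n → ℕ) → Set
IsBijLabeling n f =
  (∀ v → 1 ℕ.≤ f v × f v ℕ.≤ n)
  × Injective _≡_ _≡_ f
  × (∀ k → 1 ℕ.≤ k → k ℕ.≤ n → ∃ λ v → f v ≡ k)

IsDDMLabeling : ∀ {n} → Digraph n → (Fin n → ℕ) → Set
IsDDMLabeling {n} D f = IsBijLabeling n f × (∀ v → wt D f v ≡ + 0)

IsDDMOG : ∀ {n} → Digraph n → Set
IsDDMOG {n} D = IsOriented D × Σ (Fin n → ℕ) (λ f → IsDDMLabeling D f)

-- Weighted sum  G ⊕^s_{wt_h} H  on the vertex set Fin (n + m):
-- G-vertices come first (inj₁ of splitAt), H-vertices after (inj₂).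
-- The G-vertex v is v_i with i = g v.
weightedSum : ∀ {n m} → Digraph n → (Fin n → ℕ) → ℤ →
              Digraph m → (Fin m → ℕ) → Digraph (n ℕ.+ m)
weightedSum {n} {m} G g s H h x y with splitAt n x | splitAt n y
... | inj₁ a | inj₁ b = G a b
... | inj₂ a | inj₂ b = H a b
... | inj₁ a | inj₂ u = does (wt H h u ℤ.≟ - (+ g a ℤ.+ s))
... | inj₂ u | inj₁ b = does (wt H h u ℤ.≟ (+ g b ℤ.+ s))

-- Label the vertex v_i of G by i + m and keep h on H. At v_i the arcs of G contribute
-- wt_g(v_i) + m · imb(v_i) = 0, and the new arcs contribute the difference of the h-sums over
-- the levels i + m and −(i + m) of wt_h, which vanishes by hypothesis. A vertex u of H with
-- wt_h(u) = ±(i + m) gets exactly one new arc, to or from v_i, whose label i + m cancels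
-- wt_h(u); such a v_i exists because g is onto {1, …, n}.
module Submission where

open import Defs
open import Data.Nat using (ℕ; _+_; _≤_)
open import Data.Integer using (ℤ; +_; -_; ∣_∣; _≟_)
open import Data.Fin using (Fin)
open import Data.Bool using (if_then_else_)
open import Data.Sum using (_⊎_)
open import Data.Product using (_×_)
open import Relation.Binary.PropositionalEquality using (_≡_)
open import Relation.Nullary using (does)

open import Data.Bool using (Bool; true; false)
open import Data.Nat using (zero; suc; _*_; _∸_; _≤?_)
import Data.Nat.Properties as ℕₚ
open import Data.Nat.Tactic.RingSolver as ℕ-Ring using ()
open import Data.Integer as ℤ using (-[1+_])
import Data.Integer.Properties as ℤₚ
open import Data.Integer.Tactic.RingSolver as ℤ-Ring using ()
open import Data.Fin using (zero; suc; _↑ˡ_; _↑ʳ_; splitAt; join)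
open import Data.Fin.Properties using (splitAt-↑ˡ; splitAt-↑ʳ; join-splitAt; suc-injective)
open import Data.Sum using (inj₁; inj₂; [_,_]′)
open import Data.Product using (_,_; proj₁; proj₂; ∃)
open import Data.Empty using (⊥-elim)
open import Function using (_∘_)
open import Function.Definitions using (Injective)
open import Relation.Binary.PropositionalEquality
  using (_≢_; refl; sym; trans; cong; cong₂; subst; module ≡-Reasoning)
open import Relation.Nullary using (Dec; yes; no)
open import Relation.Nullary.Decidable using (dec-true; dec-false)

↑ˡ-↑ʳ-elim : ∀ {n m ℓ} {P : Fin (n + m) → Set ℓ} →
             (∀ a → P (a ↑ˡ m)) → (∀ u → P (n ↑ʳ u)) → ∀ x → P x
↑ˡ-↑ʳ-elim {n} {m} {P = P} left right x = subst P (join-splitAt n m x) (by-side (splitAt n x))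
  where
  by-side : ∀ s → P (join n m s)
  by-side (inj₁ a) = left a
  by-side (inj₂ u) = right u

does-true : ∀ {p} {A : Set p} (a? : Dec A) → does a? ≡ true → A
does-true (yes a) _ = a

pos≢neg : ∀ k {x} → 1 ≤ x → + k ≢ - + x
pos≢neg k {suc x} _ ()

sumℤ-cong : ∀ n {F F′ : Fin n → ℤ} → (∀ i → F i ≡ F′ i) → sumℤ n F ≡ sumℤ n F′
sumℤ-cong zero    F≗F′ = refl
sumℤ-cong (suc n) F≗F′ = cong₂ ℤ._+_ (F≗F′ zero) (sumℤ-cong n (F≗F′ ∘ suc))

sumℤ-++ : ∀ n m (F : Fin (n + m) → ℤ) →
          sumℤ (n + m) F ≡ sumℤ n (F ∘ (_↑ˡ m)) ℤ.+ sumℤ m (F ∘ (n ↑ʳ_))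
sumℤ-++ zero    m F = sym (ℤₚ.+-identityˡ _)
sumℤ-++ (suc n) m F rewrite sumℤ-++ n m (F ∘ suc) = sym (ℤₚ.+-assoc (F zero) _ _)

sumℕ-if-shift : ∀ k (c : Fin k → Bool) (f : Fin k → ℕ) s →
  sumℕ k (λ u → if c u then f u + s else 0)
  ≡ sumℕ k (λ u → if c u then f u else 0) + s * sumℕ k (λ u → if c u then 1 else 0)
sumℕ-if-shift zero    c f s = sym (ℕₚ.*-zeroʳ s)
sumℕ-if-shift (suc k) c f s with c zero
... | true  rewrite sumℕ-if-shift k (c ∘ suc) (f ∘ suc) s =
  regroup (f zero) s (sumℕ k (λ u → if c (suc u) then f (suc u) else 0))
          (sumℕ k (λ u → if c (suc u) then 1 else 0))
  where
  regroup : ∀ a s b c → a + s + (b + s * c) ≡ a + b + s * (1 + c)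
  regroup = ℕ-Ring.solve-∀
... | false = sumℕ-if-shift k (c ∘ suc) (f ∘ suc) s

sumIf : ∀ k → (Fin k → Bool) → (Fin k → ℕ) → ℤ
sumIf k c f = sumℤ k (λ u → if c u then + f u else + 0)

-- wt D f v unfolds to flow n (λ u → D u v) (D v) f.
flow : ∀ k → (into outof : Fin k → Bool) → (Fin k → ℕ) → ℤ
flow k into outof f = sumIf k into f ℤ.- sumIf k outof f

sumIf-cong : ∀ k {c c′ : Fin k → Bool} {f f′ : Fin k → ℕ} →
             (∀ u → c u ≡ c′ u) → (∀ u → f u ≡ f′ u) → sumIf k c f ≡ sumIf k c′ f′
sumIf-cong k c≗c′ f≗f′ =
  sumℤ-cong k (λ u → cong₂ (λ b x → if b then + x else + 0) (c≗c′ u) (f≗f′ u))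

sumIf-ℕ : ∀ k (c : Fin k → Bool) (f : Fin k → ℕ) →
          sumIf k c f ≡ + sumℕ k (λ u → if c u then f u else 0)
sumIf-ℕ zero    c f = refl
sumIf-ℕ (suc k) c f with c zero
... | true  = cong (ℤ._+_ (+ f zero)) (sumIf-ℕ k (c ∘ suc) (f ∘ suc))
... | false = trans (ℤₚ.+-identityˡ _) (sumIf-ℕ k (c ∘ suc) (f ∘ suc))

sumIf-none : ∀ k (c : Fin k → Bool) (f : Fin k → ℕ) → (∀ u → c u ≡ false) → sumIf k c f ≡ + 0
sumIf-none zero    c f none = refl
sumIf-none (suc k) c f none rewrite none zero | sumIf-none k (c ∘ suc) (f ∘ suc) (none ∘ suc) = refl

sumIf-single : ∀ k (c : Fin k → Bool) (f : Fin k → ℕ) a →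
               c a ≡ true → (∀ u → u ≢ a → c u ≡ false) → sumIf k c f ≡ + f a
sumIf-single (suc k) c f zero ca others rewrite ca
  | sumIf-none k (c ∘ suc) (f ∘ suc) (λ u → others (suc u) λ ()) = ℤₚ.+-identityʳ _
sumIf-single (suc k) c f (suc a) ca others rewrite others zero (λ ()) =
  trans (ℤₚ.+-identityˡ _)
        (sumIf-single k (c ∘ suc) (f ∘ suc) a ca (λ u u≢a → others (suc u) (u≢a ∘ suc-injective)))

sumIf-shift : ∀ k (c : Fin k → Bool) (f : Fin k → ℕ) s →
  sumIf k c (λ u → f u + s) ≡ sumIf k c f ℤ.+ + s ℤ.* + sumℕ k (λ u → if c u then 1 else 0)
sumIf-shift k c f s = begin
  sumIf k c (λ u → f u + s)                    ≡⟨ sumIf-ℕ k c _ ⟩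
  + sumℕ k (λ u → if c u then f u + s else 0)  ≡⟨ cong +_ (sumℕ-if-shift k c f s) ⟩
  + (Σf + s * count)                           ≡⟨ ℤₚ.pos-+ Σf (s * count) ⟩
  + Σf ℤ.+ + (s * count)                       ≡⟨ cong₂ ℤ._+_ (sym (sumIf-ℕ k c f)) (ℤₚ.pos-* s count) ⟩
  sumIf k c f ℤ.+ + s ℤ.* + count              ∎
  where
  open ≡-Reasoning
  Σf count : ℕ
  Σf = sumℕ k (λ u → if c u then f u else 0)
  count = sumℕ k (λ u → if c u then 1 else 0)

flow-cong : ∀ k {i i′ o o′ : Fin k → Bool} {f f′ : Fin k → ℕ} →
            (∀ u → i u ≡ i′ u) → (∀ u → o u ≡ o′ u) → (∀ u → f u ≡ f′ u) →
            flow k i o f ≡ flow k i′ o′ f′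
flow-cong k i≗i′ o≗o′ f≗f′ = cong₂ ℤ._-_ (sumIf-cong k i≗i′ f≗f′) (sumIf-cong k o≗o′ f≗f′)

flow-++ : ∀ n m (i o : Fin (n + m) → Bool) (f : Fin (n + m) → ℕ) →
          flow (n + m) i o f
          ≡ flow n (i ∘ (_↑ˡ m)) (o ∘ (_↑ˡ m)) (f ∘ (_↑ˡ m)) ℤ.+ flow m (i ∘ (n ↑ʳ_)) (o ∘ (n ↑ʳ_)) (f ∘ (n ↑ʳ_))
flow-++ n m i o f =
  trans (cong₂ ℤ._-_ (sumℤ-++ n m _) (sumℤ-++ n m _))
        (interchange (left i) (right i) (left o) (right o))
  where
  left : (Fin (n + m) → Bool) → ℤ
  left c = sumIf n (c ∘ (_↑ˡ m)) (f ∘ (_↑ˡ m))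
  right : (Fin (n + m) → Bool) → ℤ
  right c = sumIf m (c ∘ (n ↑ʳ_)) (f ∘ (n ↑ʳ_))
  interchange : ∀ a b c d → (a ℤ.+ b) ℤ.- (c ℤ.+ d) ≡ (a ℤ.- c) ℤ.+ (b ℤ.- d)
  interchange = ℤ-Ring.solve-∀

flow-balanced : ∀ k (i o : Fin k → Bool) (f : Fin k → ℕ) →
                sumℕ k (λ u → if i u then f u else 0) ≡ sumℕ k (λ u → if o u then f u else 0) →
                flow k i o f ≡ + 0
flow-balanced k i o f balanced rewrite sumIf-ℕ k i f | sumIf-ℕ k o f | balanced =
  ℤₚ.+-inverseʳ (+ sumℕ k (λ u → if o u then f u else 0))

wt-shift : ∀ {n} (G : Digraph n) (g : Fin n → ℕ) s v →
           wt G (λ u → g u + s) v ≡ wt G g v ℤ.+ + s ℤ.* imb G v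
wt-shift {n} G g s v =
  trans (cong₂ ℤ._-_ (sumIf-shift n (λ u → G u v) g s) (sumIf-shift n (G v) g s))
        (distribute (sumIf n (λ u → G u v) g) (sumIf n (G v) g) (+ s) (+ indeg G v) (+ outdeg G v))
  where
  distribute : ∀ a b s i o → (a ℤ.+ s ℤ.* i) ℤ.- (b ℤ.+ s ℤ.* o) ≡ (a ℤ.- b) ℤ.+ s ℤ.* (i ℤ.- o)
  distribute = ℤ-Ring.solve-∀

flow-levels : ∀ {k} (F : Fin k → ℕ) → (∀ a → 1 ≤ F a) → Injective _≡_ _≡_ F →
              ∀ w → (∃ λ a → ∣ w ∣ ≡ F a) ⊎ w ≡ + 0 →
              flow k (λ b → does (w ≟ - + F b)) (λ b → does (w ≟ + F b)) F ≡ - w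
flow-levels {k} F F≥1 F-inj (+ x) (inj₁ (a , x≡Fa)) = begin
  flow k (λ b → does (+ x ≟ - + F b)) (λ b → does (+ x ≟ + F b)) F
    ≡⟨ cong₂ ℤ._-_ (sumIf-none k _ F (λ b → dec-false (+ x ≟ - + F b) (pos≢neg x (F≥1 b))))
                   (sumIf-single k _ F a (dec-true (+ x ≟ + F a) (cong +_ x≡Fa)) other) ⟩
  + 0 ℤ.- + F a  ≡⟨ ℤₚ.+-identityˡ (- + F a) ⟩
  - + F a        ≡⟨ cong (-_ ∘ +_) x≡Fa ⟨
  - + x          ∎
  where
  open ≡-Reasoning
  other : ∀ b → b ≢ a → does (+ x ≟ + F b) ≡ false
  other b b≢a = dec-false (+ x ≟ + F b) (λ e → b≢a (F-inj (trans (sym (ℤₚ.+-injective e)) x≡Fa)))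
flow-levels {k} F F≥1 F-inj -[1+ x ] (inj₁ (a , x+1≡Fa)) = begin
  flow k (λ b → does (-[1+ x ] ≟ - + F b)) (λ b → does (-[1+ x ] ≟ + F b)) F
    ≡⟨ cong₂ ℤ._-_ (sumIf-single k _ F a (dec-true (-[1+ x ] ≟ - + F a) (cong (-_ ∘ +_) x+1≡Fa)) other)
                   (sumIf-none k _ F (λ b → dec-false (-[1+ x ] ≟ + F b) λ ())) ⟩
  + F a ℤ.- + 0  ≡⟨ ℤₚ.+-identityʳ (+ F a) ⟩
  + F a          ≡⟨ cong +_ x+1≡Fa ⟨
  - -[1+ x ]     ∎
  where
  open ≡-Reasoning
  other : ∀ b → b ≢ a → does (-[1+ x ] ≟ - + F b) ≡ false
  other b b≢a = dec-false (-[1+ x ] ≟ - + F b)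
    (λ e → b≢a (F-inj (trans (sym (ℤₚ.+-injective (ℤₚ.neg-injective e))) x+1≡Fa)))
flow-levels {k} F F≥1 F-inj _ (inj₂ refl) =
  cong₂ ℤ._-_ (sumIf-none k _ F (λ b → dec-false (+ 0 ≟ - + F b) (pos≢neg 0 (F≥1 b))))
              (sumIf-none k _ F (λ b → dec-false (+ 0 ≟ + F b) (ℕₚ.<⇒≢ (F≥1 b) ∘ ℤₚ.+-injective)))

joinLabels : ∀ {n m} → (Fin n → ℕ) → ℕ → (Fin m → ℕ) → Fin (n + m) → ℕ
joinLabels {n} g s h x = [ (λ a → g a + s) , h ]′ (splitAt n x)

module _ {n m} (g : Fin n → ℕ) (s : ℕ) (h : Fin m → ℕ) where

  joinLabels-↑ˡ : ∀ a → joinLabels g s h (a ↑ˡ m) ≡ g a + s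
  joinLabels-↑ˡ a rewrite splitAt-↑ˡ n a m = refl

  joinLabels-↑ʳ : ∀ u → joinLabels g s h (n ↑ʳ u) ≡ h u
  joinLabels-↑ʳ u rewrite splitAt-↑ʳ n m u = refl

shift-onto : ∀ {n} {g : Fin n → ℕ} m → IsBijLabeling n g →
             ∀ k → m + 1 ≤ k → k ≤ m + n → ∃ λ a → g a + m ≡ k
shift-onto {n} {g} m (_ , _ , g-onto) k m+1≤k k≤m+n =
  a , trans (cong (_+ m) ga≡k∸m) (ℕₚ.m∸n+n≡m (ℕₚ.≤-trans (ℕₚ.m≤m+n m 1) m+1≤k))
  where
  1≤k∸m : 1 ≤ k ∸ m
  1≤k∸m = subst (_≤ k ∸ m) (ℕₚ.m+n∸m≡n m 1) (ℕₚ.∸-monoˡ-≤ m m+1≤k)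
  k∸m≤n : k ∸ m ≤ n
  k∸m≤n = subst (k ∸ m ≤_) (ℕₚ.m+n∸m≡n m n) (ℕₚ.∸-monoˡ-≤ m k≤m+n)
  a : Fin n
  a = proj₁ (g-onto (k ∸ m) 1≤k∸m k∸m≤n)
  ga≡k∸m : g a ≡ k ∸ m
  ga≡k∸m = proj₂ (g-onto (k ∸ m) 1≤k∸m k∸m≤n)

joinLabels-isBij : ∀ {n m} {g : Fin n → ℕ} {h : Fin m → ℕ} →
                   IsBijLabeling n g → IsBijLabeling m h → IsBijLabeling (n + m) (joinLabels g m h)
joinLabels-isBij {n} {m} {g} {h} g-bij@(g-range , g-inj , _) (h-range , h-inj , h-onto) =
  ↑ˡ-↑ʳ-elim range-G range-H , injective , onto
  where
  f : Fin (n + m) → ℕ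
  f = joinLabels g m h

  range-G : ∀ a → 1 ≤ f (a ↑ˡ m) × f (a ↑ˡ m) ≤ n + m
  range-G a rewrite joinLabels-↑ˡ g m h a =
    ℕₚ.≤-trans (proj₁ (g-range a)) (ℕₚ.m≤m+n _ m) , ℕₚ.+-monoˡ-≤ m (proj₂ (g-range a))

  range-H : ∀ u → 1 ≤ f (n ↑ʳ u) × f (n ↑ʳ u) ≤ n + m
  range-H u rewrite joinLabels-↑ʳ g m h u =
    proj₁ (h-range u) , ℕₚ.≤-trans (proj₂ (h-range u)) (ℕₚ.m≤n+m m n)

  -- Labels of H lie in [1, m], labels of G in [m + 1, m + n].
  injective-⊎ : Injective _≡_ _≡_ [ (λ a → g a + m) , h ]′
  injective-⊎ {inj₁ a} {inj₁ b} e = cong inj₁ (g-inj (ℕₚ.+-cancelʳ-≡ m _ _ e))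
  injective-⊎ {inj₁ a} {inj₂ u} e = ⊥-elim (ℕₚ.<-irrefl (sym e)
    (ℕₚ.≤-<-trans (proj₂ (h-range u)) (ℕₚ.+-monoˡ-≤ m (proj₁ (g-range a)))))
  injective-⊎ {inj₂ u} {inj₁ b} e = sym (injective-⊎ (sym e))
  injective-⊎ {inj₂ u} {inj₂ v} e = cong inj₂ (h-inj e)

  injective : Injective _≡_ _≡_ f
  injective {x} {y} e = begin
    x                      ≡⟨ join-splitAt n m x ⟨
    join n m (splitAt n x) ≡⟨ cong (join n m) (injective-⊎ {splitAt n x} {splitAt n y} e) ⟩
    join n m (splitAt n y) ≡⟨ join-splitAt n m y ⟩
    y                      ∎
    where open ≡-Reasoning

  onto : ∀ k → 1 ≤ k → k ≤ n + m → ∃ λ x → f x ≡ k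
  onto k 1≤k k≤n+m with k ≤? m
  ... | yes k≤m = let (u , hu≡k) = h-onto k 1≤k k≤m in
    n ↑ʳ u , trans (joinLabels-↑ʳ g m h u) hu≡k
  ... | no k≰m = let (a , ga+m≡k) = shift-onto m g-bij k m+1≤k (subst (k ≤_) (ℕₚ.+-comm n m) k≤n+m) in
    a ↑ˡ m , trans (joinLabels-↑ˡ g m h a) ga+m≡k
    where
    m+1≤k : m + 1 ≤ k
    m+1≤k = subst (_≤ k) (ℕₚ.+-comm 1 m) (ℕₚ.≰⇒> k≰m)

module WeightedSum {n m} (G : Digraph n) (g : Fin n → ℕ) (s : ℕ) (H : Digraph m) (h : Fin m → ℕ) where

  D : Digraph (n + m)
  D = weightedSum G g (+ s) H h

  f : Fin (n + m) → ℕ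
  f = joinLabels g s h

  arc-GG : ∀ a b → D (a ↑ˡ m) (b ↑ˡ m) ≡ G a b
  arc-GG a b rewrite splitAt-↑ˡ n a m | splitAt-↑ˡ n b m = refl

  arc-GH : ∀ a u → D (a ↑ˡ m) (n ↑ʳ u) ≡ does (wt H h u ≟ - + (g a + s))
  arc-GH a u rewrite splitAt-↑ˡ n a m | splitAt-↑ʳ n m u = refl

  arc-HG : ∀ u a → D (n ↑ʳ u) (a ↑ˡ m) ≡ does (wt H h u ≟ + (g a + s))
  arc-HG u a rewrite splitAt-↑ˡ n a m | splitAt-↑ʳ n m u = refl

  arc-HH : ∀ u v → D (n ↑ʳ u) (n ↑ʳ v) ≡ H u v
  arc-HH u v rewrite splitAt-↑ʳ n m u | splitAt-↑ʳ n m v = refl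

  isOriented : (∀ a → 1 ≤ g a + s) → IsOriented G → IsOriented H → IsOriented D
  isOriented level≥1 (G-loopless , G-asym) (H-loopless , H-asym) = loopless , asym
    where
    opposite : ∀ a u → wt H h u ≡ - + (g a + s) → wt H h u ≢ + (g a + s)
    opposite a u e e′ = pos≢neg _ (level≥1 a) (trans (sym e′) e)

    loopless : ∀ x → D x x ≡ false
    loopless = ↑ˡ-↑ʳ-elim (λ a → trans (arc-GG a a) (G-loopless a))
                          (λ u → trans (arc-HH u u) (H-loopless u))

    asym : ∀ x y → D x y ≡ true → D y x ≡ false
    asym = ↑ˡ-↑ʳ-elim
      (λ a → ↑ˡ-↑ʳ-elim
        (λ b ab → trans (arc-GG b a) (G-asym a b (trans (sym (arc-GG a b)) ab)))
        (λ u au → trans (arc-HG u a) (dec-false (wt H h u ≟ _)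
          (opposite a u (does-true (wt H h u ≟ _) (trans (sym (arc-GH a u)) au))))))
      (λ u → ↑ˡ-↑ʳ-elim
        (λ b ub → trans (arc-GH b u) (dec-false (wt H h u ≟ _)
          (λ e → opposite b u e (does-true (wt H h u ≟ _) (trans (sym (arc-HG u b)) ub)))))
        (λ v uv → trans (arc-HH v u) (H-asym u v (trans (sym (arc-HH u v)) uv))))

  weight-↑ˡ : ∀ a → wt D f (a ↑ˡ m)
    ≡ wt G (λ b → g b + s) a
      ℤ.+ flow m (λ u → does (wt H h u ≟ + (g a + s))) (λ u → does (wt H h u ≟ - + (g a + s))) h
  weight-↑ˡ a = trans (flow-++ n m (λ y → D y (a ↑ˡ m)) (D (a ↑ˡ m)) f) (cong₂ ℤ._+_
    (flow-cong n (λ b → arc-GG b a) (arc-GG a) (joinLabels-↑ˡ g s h))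
    (flow-cong m (λ u → arc-HG u a) (arc-GH a) (joinLabels-↑ʳ g s h)))

  weight-↑ʳ : ∀ u → wt D f (n ↑ʳ u)
    ≡ flow n (λ b → does (wt H h u ≟ - + (g b + s))) (λ b → does (wt H h u ≟ + (g b + s))) (λ b → g b + s)
      ℤ.+ wt H h u
  weight-↑ʳ u = trans (flow-++ n m (λ y → D y (n ↑ʳ u)) (D (n ↑ʳ u)) f) (cong₂ ℤ._+_
    (flow-cong n (λ b → arc-GH b u) (arc-HG u) (joinLabels-↑ˡ g s h))
    (flow-cong m (λ v → arc-HH v u) (arc-HH u) (joinLabels-↑ʳ g s h)))

theorem7 : (n m : ℕ) (G : Digraph n) (g : Fin n → ℕ) (H : Digraph m) (h : Fin m → ℕ) →
    IsOriented G → IsDDMLabeling G g → ImbZero G →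
    IsOriented H → IsBijLabeling m h →
    (∀ v → (m + 1 ≤ ∣ wt H h v ∣ × ∣ wt H h v ∣ ≤ m + n) ⊎ wt H h v ≡ + 0) →
    (∀ i → 1 ≤ i → i ≤ n →
      sumℕ m (λ v → if does (wt H h v ≟ + (i + m)) then h v else 0)
      ≡ sumℕ m (λ v → if does (wt H h v ≟ - + (i + m)) then h v else 0)) →
    IsDDMOG (weightedSum G g (+ m) H h)
theorem7 n m G g H h G-oriented (g-bij , g-weights) G-balanced H-oriented h-bij h-levels h-balanced =
  isOriented label≥1 G-oriented H-oriented , f , joinLabels-isBij g-bij h-bij , ↑ˡ-↑ʳ-elim weight-G weight-H
  where
  open WeightedSum G g m H h
  g≥1 : ∀ a → 1 ≤ g a
  g≥1 a = proj₁ (proj₁ g-bij a)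

  label≥1 : ∀ a → 1 ≤ g a + m
  label≥1 a = ℕₚ.≤-trans (g≥1 a) (ℕₚ.m≤m+n (g a) m)

  shifted-weight : ∀ a → wt G (λ b → g b + m) a ≡ + 0
  shifted-weight a = trans (wt-shift G g m a)
    (trans (cong₂ (λ w i → w ℤ.+ + m ℤ.* i) (g-weights a) (G-balanced a))
           (cong (ℤ._+_ (+ 0)) (ℤₚ.*-zeroʳ (+ m))))

  weight-G : ∀ a → wt D f (a ↑ˡ m) ≡ + 0
  weight-G a = trans (weight-↑ˡ a) (cong₂ ℤ._+_ (shifted-weight a)
    (flow-balanced m _ _ h (h-balanced (g a) (g≥1 a) (proj₂ (proj₁ g-bij a)))))

  level : ∀ u → (∃ λ a → ∣ wt H h u ∣ ≡ g a + m) ⊎ wt H h u ≡ + 0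
  level u with h-levels u
  ... | inj₁ (lo , hi) = let (a , e) = shift-onto m g-bij _ lo hi in inj₁ (a , sym e)
  ... | inj₂ zero-weight = inj₂ zero-weight

  weight-H : ∀ u → wt D f (n ↑ʳ u) ≡ + 0
  weight-H u = trans (weight-↑ʳ u) (trans
    (cong (λ x → x ℤ.+ wt H h u)
      (flow-levels (λ b → g b + m) label≥1 (proj₁ (proj₂ g-bij) ∘ ℕₚ.+-cancelʳ-≡ m _ _) (wt H h u) (level u)))
    (ℤₚ.+-inverseˡ (wt H h u)))
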